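{- Let $m\ge 0$ and $n\ge 0$ be integers. Then $u(m,n)$ equals the number of partitions $\lambda$ of $n$ satisfying all three of the following conditions: (1) $\mathrm{rank}(\lambda)\le -m-1$ if $m\ge 1$, and $\mathrm{rank}(\lambda)\le 0$ if $m=0$; (2) $m-1$ belongs to the rank-set of $\lambda$; (3) if $m\ge 2$, then $\lambda_1>\lambda_2>\cdots>\lambda_m$.
   Context: A strongly unimodal sequence of weight $n$ is a finite sequence of positive integers $(a_1,\ldots,a_\ell)$ such that, for some $k$ with $1\le k\le\ell$, $$a_1<\cdots<a_{k-1}<a_k>a_{k+1}>\cdots>a_\ell\ge 1,$$ and $\sum_i a_i=n$. Its rank is $\ell-2k+1$. $u(m,n)$ is the number of strongly unimodal sequences of weight $n$ and rank $m$. A partition $\lambda=(\lambda_1\ge\lambda_2\ge\cdots\ge\lambda_{\ell(\lambda)}\ge 1)$ has length $\ell(\lambda)$. By convention $\lambda_k=0$ for $k>\ell(\lambda)$. Dyson's rank is $\mathrm{rank}(\lambda)=\lambda_1-\ell(\lambda)$. The rank-set of $\lambda$ is the infinite strictly increasing sequence $$(-\lambda_1,\,1-\lambda_2,\,2-\lambda_3,\ldots,\,j-\lambda_{j+1},\ldots),$$ that is, the set $\{j-\lambda_{j+1}: j\ge 0\}$. It equals $(-\lambda_1,\ldots,\ell(\lambda)-1-\lambda_{\ell(\lambda)},\ell(\lambda),\ell(\lambda)+1,\ldots)$. -}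

module Defs where

open import Data.Nat using (ℕ; zero; suc; _≤_; _<_; _>_; _*_)
open import Data.Integer as ℤ using (ℤ; +_; 0ℤ; 1ℤ)
open import Data.Nat.ListAction using (sum)
open import Data.List using (List; []; _∷_; length; take; drop; map; upTo)
open import Data.List.Relation.Unary.All using (All)
open import Data.List.Relation.Unary.Linked using (Linked)
open import Data.Product using (Σ; _×_)
open import Data.Fin using (Fin)
open import Function.Bundles using (_↔_)
open import Relation.Binary.PropositionalEquality using (_≡_)

-- A list a = (a_1,…,a_ℓ) of positive integers together with a peak
-- position k (1 ≤ k ≤ ℓ) such that a_1 < … < a_k > … > a_ℓ,
-- of weight n and rank ℓ - 2k + 1 = m.  (The peak position k is
-- uniquely determined by a, so counting pairs (a , proof) counts
-- sequences.)
IsSUS : (m n : ℕ) → List ℕ → Set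
IsSUS m n a = Σ ℕ λ k →
    (1 ≤ k) × (k ≤ length a)
  × Linked _<_ (take k a)
  × Linked _>_ (drop (k Data.Nat.∸ 1) a)
  × All (1 ≤_) a
  × (sum a ≡ n)
  × ((+ length a ℤ.- + (2 * k)) ℤ.+ 1ℤ ≡ + m)

USet : ℕ → ℕ → Set
USet m n = Σ (List ℕ) (IsSUS m n)

IsPartitionOf : ℕ → List ℕ → Set
IsPartitionOf n λs = Linked _≥_ λs × All (1 ≤_) λs × (sum λs ≡ n)
  where open Data.Nat using (_≥_)

-- nth λ j = λ_{j+1}, with the convention λ_k = 0 for k > ℓ(λ).
nth : List ℕ → ℕ → ℕ
nth []       _       = 0
nth (x ∷ xs) zero    = x
nth (x ∷ xs) (suc j) = nth xs j

rank : List ℕ → ℤ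
rank λs = + nth λs 0 ℤ.- + length λs

InRankSet : ℤ → List ℕ → Set
InRankSet x λs = Σ ℕ λ j → (+ j ℤ.- + nth λs j) ≡ x

Cond1 : ℕ → List ℕ → Set
Cond1 zero    λs = rank λs ℤ.≤ 0ℤ
Cond1 (suc k) λs = rank λs ℤ.≤ (ℤ.- (+ suc k)) ℤ.- 1ℤ

Cond3 : ℕ → List ℕ → Set
Cond3 m λs = Linked _>_ (map (nth λs) (upTo m))

PSet : ℕ → ℕ → Set
PSet m n = Σ (List ℕ) λ λs →
  IsPartitionOf n λs × Cond1 m λs × InRankSet (+ m ℤ.- 1ℤ) λs × Cond3 m λs

_HasSize_ : Set → ℕ → Set
A HasSize k = A ↔ Fin k

-- A strongly unimodal sequence of rank m splits at its peak c into α₁ < ⋯ < α_r < c and a strictly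
-- decreasing β of length r + m.  Recording the gaps of α₁ < ⋯ < α_r < c turns (α, c) into a partition ν
-- with parts ≤ r + 1 and c = r + 1 + ℓ(ν); adding 1, 2, …, r to the last r entries of β turns it into a
-- weakly decreasing B whose entries stay ≥ r + 1 and whose first m entries stay strictly decreasing.
-- The partition B ++ (r + 1) ∷ ν has its part r + 1 at index r + m, so m − 1 lies in its rank-set, and
-- the bound c on its largest part is condition (1).  The weight is preserved because the staircase
-- 1 + ⋯ + (r + 1) removed from (α, c) reappears as 1 + ⋯ + r added to β plus the part r + 1.
-- Both splittings are invertible, so the two sets are in bijection, and they are finite because a
-- strongly unimodal sequence of weight n is a list of length and entries at most n.

module Submission where

open import Defs
open import Data.Nat using (ℕ)
open import Data.Product using (Σ; _×_)

open import Axiom.UniquenessOfIdentityProofs using (module Decidable⇒UIP)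
open import Data.Bool.Properties using (T-irrelevant; T?)
open import Data.Empty using (⊥-elim)
open import Data.Fin as Fin using (Fin)
open import Data.Integer as ℤ using (ℤ; -[1+_]; 0ℤ; 1ℤ; _⊖_)
import Data.Integer.Properties as ℤ
open import Data.List using (List; []; _∷_; [_]; _++_; length; take; drop; map; replicate)
open import Data.List using (upTo; applyUpTo; cartesianProductWith)
import Data.List.Properties as LP
open import Data.List.Membership.Propositional using (_∈_)
open import Data.List.Membership.Propositional.Properties using (∈-cartesianProductWith⁺; ∈-upTo⁺)
open import Data.List.Relation.Unary.All as All using (All; []; _∷_)
import Data.List.Relation.Unary.All.Properties as All
open import Data.List.Relation.Unary.Any using (here; there)
open import Data.List.Relation.Unary.Linked as Lk using (Linked; []; [-]; _∷_)
open import Data.Nat using (zero; suc; pred; _+_; _*_; _∸_; _≤_; _<_; _≥_; _>_; z≤n; s≤s; s≤s⁻¹; >-nonZero)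
open import Data.Nat using (_≟_; _≤?_; _<?_; _>?_)
open import Data.Nat.ListAction using (sum)
open import Data.Nat.ListAction.Properties using (sum-++)
open import Data.Nat.Properties
open import Algebra.Properties.CommutativeSemigroup +-commutativeSemigroup using (x∙yz≈y∙xz)
open import Data.Nat.Tactic.RingSolver using (solve-∀)
open import Data.Product using (∃; _,_; proj₁; proj₂; map₁)
open import Function using (flip)
open import Function.Bundles using (_↔_; _⇔_; mk↔ₛ′; mk⇔; Inverse; Equivalence)
open import Function.Construct.Composition using (_⇔-∘_)
open import Function.Properties.Inverse using (↔-sym; ↔-trans)
open import Relation.Binary.Definitions using (DecidableEquality; Transitive; tri<; tri≈; tri>)
open import Relation.Binary.PropositionalEquality hiding ([_])
open import Relation.Nullary using (Dec; yes; no; contradiction; Irrelevant)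
import Relation.Nullary.Decidable as Dec
open import Relation.Nullary.Decidable using (False; fromWitnessFalse; toWitnessFalse; _×-dec_)
import Relation.Unary as U

Σ-≡ : {A : Set} {P : A → Set} → U.Irrelevant P → {x y : Σ A P} → proj₁ x ≡ proj₁ y → x ≡ y
Σ-≡ irr {a , p} {.a , q} refl = cong (a ,_) (irr p q)

mk↔-Σ : {A B : Set} {P : A → Set} {Q : B → Set} → U.Irrelevant P → U.Irrelevant Q →
        (to : Σ A P → Σ B Q) (from : Σ B Q → Σ A P) →
        (∀ y → proj₁ (to (from y)) ≡ proj₁ y) → (∀ x → proj₁ (from (to x)) ≡ proj₁ x) →
        Σ A P ↔ Σ B Q
mk↔-Σ irrP irrQ to from to∘from from∘to =
  mk↔ₛ′ to from (λ y → Σ-≡ irrQ (to∘from y)) (λ x → Σ-≡ irrP (from∘to x))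

infixr 2 _×-irrelevant_

_×-irrelevant_ : {A B : Set} → Irrelevant A → Irrelevant B → Irrelevant (A × B)
(irrA ×-irrelevant irrB) (a , b) (a′ , b′) = cong₂ _,_ (irrA a a′) (irrB b b′)

module _ {A : Set} (_≟ᴬ_ : DecidableEquality A) where

  -- False rather than ≢, so that the restricted predicate stays irrelevant without function extensionality
  Without : (A → Set) → A → A → Set
  Without P x a = P a × False (a ≟ᴬ x)

  ↔-insert : {P : A → Set} {x : A} {k : ℕ} → U.Irrelevant P → P x →
             Σ A (Without P x) ↔ Fin k → Σ A P ↔ Fin (suc k)
  ↔-insert {P} {x} {k} irr px rest = mk↔ₛ′ to from to∘from from∘to
    where
    open Inverse rest renaming (to to toʳ; from to fromʳ; inverseˡ to toʳ∘fromʳ; inverseʳ to fromʳ∘toʳ)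
    to′ : ∀ a → P a → Dec (a ≡ x) → Fin (suc k)
    to′ a p (yes _) = Fin.zero
    to′ a p (no a≢x) = Fin.suc (toʳ (a , p , fromWitnessFalse a≢x))
    to : Σ A P → Fin (suc k)
    to (a , p) = to′ a p (a ≟ᴬ x)
    from : Fin (suc k) → Σ A P
    from Fin.zero = x , px
    from (Fin.suc i) = let (a , p , _) = fromʳ i in a , p
    to′-≢ : ∀ a p a≢x d → to′ a p d ≡ Fin.suc (toʳ (a , p , a≢x))
    to′-≢ a p a≢x (yes a≡x) = ⊥-elim (toWitnessFalse a≢x a≡x)
    to′-≢ a p a≢x (no _) = cong (λ w → Fin.suc (toʳ (a , p , w))) (T-irrelevant _ _)
    to∘from : ∀ i → to (from i) ≡ i
    to∘from Fin.zero with x ≟ᴬ x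
    ... | yes _ = refl
    ... | no x≢x = ⊥-elim (x≢x refl)
    to∘from (Fin.suc i) = trans (to′-≢ _ _ (proj₂ (proj₂ (fromʳ i))) _) (cong Fin.suc (toʳ∘fromʳ refl))
    from∘to : ∀ y → from (to y) ≡ y
    from∘to (a , p) with a ≟ᴬ x
    ... | yes refl = cong (x ,_) (irr px p)
    ... | no _ = cong (λ (a , p , _) → a , p) (fromʳ∘toʳ refl)

  finite : (xs : List A) (P : A → Set) → U.Decidable P → U.Irrelevant P → (∀ {a} → P a → a ∈ xs) →
           ∃ λ k → Σ A P ↔ Fin k
  finite [] P P? irr ⊆xs = 0 , mk↔ₛ′ (λ (_ , p) → ∉[] (⊆xs p)) (λ ()) (λ ()) (λ (_ , p) → ∉[] (⊆xs p))
    where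
    ∉[] : ∀ {a B} → a ∈ [] → B
    ∉[] ()
  finite (x ∷ xs) P P? irr ⊆x∷xs with P? x
  ... | no ¬px = finite xs P P? irr ⊆xs
    where
    ⊆xs : ∀ {a} → P a → a ∈ xs
    ⊆xs p with ⊆x∷xs p
    ... | here refl  = ⊥-elim (¬px p)
    ... | there a∈xs = a∈xs
  ... | yes px =
    let (k , rest) = finite xs (Without P x) (λ a → P? a ×-dec T? _) irr′ ⊆xs
    in suc k , ↔-insert irr px rest
    where
    irr′ : U.Irrelevant (Without P x)
    irr′ = irr ×-irrelevant T-irrelevant
    ⊆xs : ∀ {a} → Without P x a → a ∈ xs
    ⊆xs (p , a≢x) with ⊆x∷xs p
    ... | here refl  = ⊥-elim (toWitnessFalse a≢x refl)
    ... | there a∈xs = a∈xs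

⊖-cancelʳ : ∀ m n p → (m + p) ⊖ (n + p) ≡ m ⊖ n
⊖-cancelʳ m n p = trans (cong₂ _⊖_ (+-comm m p) (+-comm n p)) (ℤ.+-cancelˡ-⊖ p m n)

⊖-+-cancel : ∀ m n p → m ⊖ n ℤ.+ ℤ.+ (n + p) ≡ ℤ.+ (m + p)
⊖-+-cancel m n p = begin
  m ⊖ n ℤ.+ ℤ.+ (n + p)  ≡⟨ ℤ.distribˡ-⊖-+-pos (n + p) m n ⟩
  (m + (n + p)) ⊖ n      ≡⟨ cong (_⊖ n) (shuffle m n p) ⟩
  (m + p + n) ⊖ (0 + n)  ≡⟨ ⊖-cancelʳ (m + p) 0 n ⟩
  ℤ.+ (m + p)            ∎
  where
  open ≡-Reasoning
  shuffle : ∀ m n p → m + (n + p) ≡ m + p + n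
  shuffle = solve-∀

⊖≡⊖⇔ : ∀ m n o p → (m ⊖ n ≡ o ⊖ p) ⇔ (m + p ≡ o + n)
⊖≡⊖⇔ m n o p = mk⇔
  (λ e → ℤ.+-injective (begin
    ℤ.+ (m + p)            ≡⟨ ⊖-+-cancel m n p ⟨
    m ⊖ n ℤ.+ ℤ.+ (n + p)  ≡⟨ cong₂ ℤ._+_ e (cong ℤ.+_ (+-comm n p)) ⟩
    o ⊖ p ℤ.+ ℤ.+ (p + n)  ≡⟨ ⊖-+-cancel o p n ⟩
    ℤ.+ (o + n)            ∎))
  (λ e → begin
    m ⊖ n              ≡⟨ ⊖-cancelʳ m n p ⟨
    (m + p) ⊖ (n + p)  ≡⟨ cong₂ _⊖_ e (+-comm n p) ⟩
    (o + n) ⊖ (p + n)  ≡⟨ ⊖-cancelʳ o p n ⟩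
    o ⊖ p              ∎)
  where open ≡-Reasoning

⊖≤⊖⇔ : ∀ m n o p → (m ⊖ n ℤ.≤ o ⊖ p) ⇔ (m + p ≤ o + n)
⊖≤⊖⇔ m n o p = mk⇔
  (λ le → ℤ.drop‿+≤+ (subst₂ ℤ._≤_ (⊖-+-cancel m n p)
            (trans (cong (λ t → o ⊖ p ℤ.+ ℤ.+ t) (+-comm n p)) (⊖-+-cancel o p n))
            (ℤ.+-monoˡ-≤ (ℤ.+ (n + p)) le)))
  (λ le → subst₂ ℤ._≤_ (⊖-cancelʳ m n p) (trans (cong ((o + n) ⊖_) (+-comm n p)) (⊖-cancelʳ o p n))
            (ℤ.⊖-monoˡ-≤ (n + p) le))

ℤ-≡-irrelevant : {i j : ℤ} → Irrelevant (i ≡ j)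
ℤ-≡-irrelevant = Decidable⇒UIP.≡-irrelevant ℤ._≟_

rank≡ : ∀ λs → rank λs ≡ nth λs 0 ⊖ length λs
rank≡ λs = ℤ.[+m]-[+n]≡m⊖n (nth λs 0) (length λs)

rank-sus⇔ : ∀ ℓ k m → ((ℤ.+ ℓ ℤ.- ℤ.+ (2 * k)) ℤ.+ 1ℤ ≡ ℤ.+ m) ⇔ (ℓ + 1 ≡ m + 2 * k)
rank-sus⇔ ℓ k m = mk⇔
  (λ e → trans (sym (+-identityʳ _)) (Equivalence.to (⊖≡⊖⇔ (ℓ + 1) (2 * k) m 0) (trans (sym lhs) e)))
  (λ e → trans lhs (Equivalence.from (⊖≡⊖⇔ (ℓ + 1) (2 * k) m 0) (trans (+-identityʳ _) e)))
  where
  lhs : (ℤ.+ ℓ ℤ.- ℤ.+ (2 * k)) ℤ.+ 1ℤ ≡ (ℓ + 1) ⊖ (2 * k)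
  lhs = trans (cong (ℤ._+ 1ℤ) (ℤ.[+m]-[+n]≡m⊖n ℓ (2 * k))) (ℤ.distribˡ-⊖-+-pos 1 ℓ (2 * k))

rank-set⇔ : ∀ j x m → (ℤ.+ j ℤ.- ℤ.+ x ≡ ℤ.+ m ℤ.- 1ℤ) ⇔ (j + 1 ≡ m + x)
rank-set⇔ j x m = subst₂ (λ a b → (a ≡ b) ⇔ (j + 1 ≡ m + x))
  (sym (ℤ.[+m]-[+n]≡m⊖n j x)) (sym (ℤ.[+m]-[+n]≡m⊖n m 1)) (⊖≡⊖⇔ j x m 1)

Under : ℕ → ℕ → ℕ → Set
Under zero    x c = x ≤ c
Under (suc _) x c = x < c

Under-+ʳ⇔ : ∀ m x y → Under m (x + m) (y + m) ⇔ Under m x y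
Under-+ʳ⇔ zero    x y = mk⇔ (+-cancelʳ-≤ 0 x y) (+-monoˡ-≤ 0)
Under-+ʳ⇔ (suc k) x y = mk⇔ (+-cancelʳ-< (suc k) x y) (+-monoˡ-< (suc k))

cond1⇔ : ∀ m λs → Cond1 m λs ⇔ Under m (nth λs 0 + m) (length λs)
cond1⇔ zero    λs = subst (λ r → (r ℤ.≤ 0ℤ) ⇔ (nth λs 0 + 0 ≤ length λs))
  (sym (rank≡ λs)) (⊖≤⊖⇔ (nth λs 0) (length λs) 0 0)
cond1⇔ (suc k) λs = subst₂ (λ r b → (r ℤ.≤ b) ⇔ Under (suc k) (nth λs 0 + suc k) (length λs))
  (sym (rank≡ λs)) (cong (λ t → -[1+ suc t ]) (sym (+-identityʳ k)))
  (subst (λ t → (nth λs 0 ⊖ length λs ℤ.≤ 0 ⊖ suc (suc k)) ⇔ (t ≤ length λs))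
     (+-suc (nth λs 0) (suc k)) (⊖≤⊖⇔ (nth λs 0) (length λs) 0 (suc (suc k))))

Split : Set
Split = List ℕ × ℕ × List ℕ

join : Split → List ℕ
join (α , c , β) = α ++ c ∷ β

pivotAt : ℕ → List ℕ → Split
pivotAt r a = take r a , nth a r , drop (suc r) a

pivotAt-join : ∀ α c β → pivotAt (length α) (join (α , c , β)) ≡ (α , c , β)
pivotAt-join []      c β = refl
pivotAt-join (x ∷ α) c β = cong (λ (α′ , c′ , β′) → x ∷ α′ , c′ , β′) (pivotAt-join α c β)

data Pivot : ℕ → List ℕ → Set where
  pivot : ∀ α c β → Pivot (length α) (join (α , c , β))

pivot? : ∀ {r a} → r < length a → Pivot r a
pivot? {zero}  {x ∷ a} _         = pivot [] x a
pivot? {suc r} {x ∷ a} (s≤s r<ℓ) with pivot? {r} {a} r<ℓ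
... | pivot α c β = pivot (x ∷ α) c β

nth-join : ∀ α c β → nth (join (α , c , β)) (length α) ≡ c
nth-join α c β = cong (λ (_ , c′ , _) → c′) (pivotAt-join α c β)

join-pivotAt : ∀ {r a} → r < length a → join (pivotAt r a) ≡ a
join-pivotAt {r} {a} r<ℓ with pivot? {r} {a} r<ℓ
... | pivot α c β = cong join (pivotAt-join α c β)

take-join : ∀ α c β → take (suc (length α)) (join (α , c , β)) ≡ α ++ [ c ]
take-join []      c β = refl
take-join (x ∷ α) c β = cong (x ∷_) (take-join α c β)

drop-join : ∀ α c β → drop (length α) (join (α , c , β)) ≡ c ∷ β
drop-join []      c β = refl
drop-join (x ∷ α) c β = drop-join α c β

length-join : ∀ α c β → length (join (α , c , β)) ≡ length α + suc (length β)
length-join α c β = LP.length-++ α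

sum-join : ∀ α c β → sum (join (α , c , β)) ≡ c + (sum α + sum β)
sum-join α c β = trans (sum-++ α (c ∷ β)) (x∙yz≈y∙xz (sum α) c (sum β))

take-++ˡ : ∀ k (xs ys : List ℕ) → k ≤ length xs → take k (xs ++ ys) ≡ take k xs
take-++ˡ zero    xs       ys _         = refl
take-++ˡ (suc k) (x ∷ xs) ys (s≤s k≤ℓ) = cong (x ∷_) (take-++ˡ k xs ys k≤ℓ)

nth-beyond : ∀ xs j → length xs ≤ j → nth xs j ≡ 0
nth-beyond []       j       _         = refl
nth-beyond (x ∷ xs) (suc j) (s≤s ℓ≤j) = nth-beyond xs j ℓ≤j

nth∈All : ∀ {P : ℕ → Set} {xs} j → j < length xs → All P xs → P (nth xs j)
nth∈All zero    _         (px ∷ _)  = px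
nth∈All (suc j) (s≤s j<ℓ) (_ ∷ pxs) = nth∈All j j<ℓ pxs

map-nth-upTo : ∀ k xs → k ≤ length xs → map (nth xs) (upTo k) ≡ take k xs
map-nth-upTo k xs k≤ℓ = trans (LP.map-upTo (nth xs) k) (applyUpTo-nth k xs k≤ℓ)
  where
  applyUpTo-nth : ∀ k xs → k ≤ length xs → applyUpTo (nth xs) k ≡ take k xs
  applyUpTo-nth zero    xs       _         = refl
  applyUpTo-nth (suc k) (x ∷ xs) (s≤s k≤ℓ) = cong (x ∷_) (applyUpTo-nth k xs k≤ℓ)

nth-antitone : ∀ {xs} i j → Linked _≥_ xs → i ≤ j → nth xs j ≤ nth xs i
nth-antitone {[]}     i       j       _ _         = z≤n
nth-antitone {x ∷ xs} zero    zero    _ _         = ≤-refl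
nth-antitone {x ∷ xs} zero    (suc j) l _         = ≤-trans (nth-antitone 0 j (Lk.tail l) z≤n) (head≤ l)
  where
  head≤ : ∀ {x xs} → Linked _≥_ (x ∷ xs) → nth xs 0 ≤ x
  head≤ [-]     = z≤n
  head≤ (p ∷ _) = p
nth-antitone {x ∷ xs} (suc i) (suc j) l (s≤s i≤j) = nth-antitone i j (Lk.tail l) i≤j

sum-replicate : ∀ g v → sum (replicate g v) ≡ g * v
sum-replicate zero    v = refl
sum-replicate (suc g) v = cong (v +_) (sum-replicate g v)

Linked-head : ∀ {R : ℕ → ℕ → Set} → Transitive R → ∀ {v xs} → Linked R (v ∷ xs) → All (R v) xs
Linked-head R-trans {v} {[]}     _       = []
Linked-head R-trans {v} {x ∷ xs} (p ∷ l) = p ∷ All.map (R-trans p) (Linked-head R-trans l)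

Linked-<-last : ∀ x xs c → Linked _<_ (x ∷ xs ++ [ c ]) → x < c
Linked-<-last x []       c (x<c ∷ _) = x<c
Linked-<-last x (y ∷ xs) c (x<y ∷ l) = <-trans x<y (Linked-<-last y xs c l)

Linked-0∷ : ∀ {xs} → Linked _<_ xs → All (1 ≤_) xs → Linked _<_ (0 ∷ xs)
Linked-0∷ {[]}    _ _       = [-]
Linked-0∷ {_ ∷ _} l (p ∷ _) = p ∷ l

Linked-≥-last : ∀ xs e → Linked _≥_ (xs ++ [ e ]) → All (e ≤_) xs
Linked-≥-last []       e _ = []
Linked-≥-last (x ∷ xs) e l = bound xs x l ∷ Linked-≥-last xs e (Lk.tail l)
  where
  bound : ∀ xs x → Linked _≥_ (x ∷ xs ++ [ e ]) → e ≤ x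
  bound []       x (p ∷ _) = p
  bound (y ∷ xs) x (p ∷ l) = ≤-trans (bound xs y l) p

Linked-≥-weaken : ∀ {a b xs} → b ≤ a → Linked _≥_ (b ∷ xs) → Linked _≥_ (a ∷ xs)
Linked-≥-weaken b≤a [-]     = [-]
Linked-≥-weaken b≤a (p ∷ l) = ≤-trans p b≤a ∷ l

Linked-≥-replicate : ∀ v g xs → Linked _≥_ (v ∷ xs) → Linked _≥_ (v ∷ replicate g v ++ xs)
Linked-≥-replicate v zero    xs l = l
Linked-≥-replicate v (suc g) xs l = ≤-refl ∷ Linked-≥-replicate v g xs l

Linked-++-split : ∀ {R : ℕ → ℕ → Set} xs y ys →
                  Linked R (xs ++ y ∷ ys) → Linked R (xs ++ [ y ]) × Linked R (y ∷ ys)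
Linked-++-split []            y ys l       = [-] , l
Linked-++-split (x ∷ [])      y ys (p ∷ l) = p ∷ [-] , l
Linked-++-split (x ∷ x′ ∷ xs) y ys (p ∷ l) = let (l₁ , l₂) = Linked-++-split (x′ ∷ xs) y ys l in p ∷ l₁ , l₂

Linked-++-join : ∀ {R : ℕ → ℕ → Set} xs y ys →
                 Linked R (xs ++ [ y ]) → Linked R (y ∷ ys) → Linked R (xs ++ y ∷ ys)
Linked-++-join []            y ys _        l = l
Linked-++-join (x ∷ [])      y ys (p ∷ _)  l = p ∷ l
Linked-++-join (x ∷ x′ ∷ xs) y ys (p ∷ l₁) l = p ∷ Linked-++-join (x′ ∷ xs) y ys l₁ l

replicate-one : ∀ ν → Linked _≥_ (1 ∷ ν) → All (1 ≤_) ν → replicate (length ν) 1 ≡ ν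
replicate-one []      _         _          = refl
replicate-one (y ∷ ν) (y≤1 ∷ l) (1≤y ∷ ps) with ≤-antisym y≤1 1≤y
... | refl = cong (1 ∷_) (replicate-one ν l ps)

-- Adding and removing a staircase

staircase : ℕ → ℕ → ℕ
staircase d zero    = 0
staircase d (suc k) = d + staircase (suc d) k

staircase-+ : ∀ g d k → staircase (g + d) k ≡ g * k + staircase d k
staircase-+ g d zero    = sym (trans (+-identityʳ (g * 0)) (*-zeroʳ g))
staircase-+ g d (suc k) = begin
  g + d + staircase (suc (g + d)) k      ≡⟨ cong (λ t → g + d + staircase t k) (+-suc g d) ⟨
  g + d + staircase (g + suc d) k        ≡⟨ cong ((g + d) +_) (staircase-+ g (suc d) k) ⟩
  g + d + (g * k + staircase (suc d) k)  ≡⟨ shuffle g d (g * k) (staircase (suc d) k) ⟩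
  g + g * k + (d + staircase (suc d) k)  ≡⟨ cong (_+ staircase d (suc k)) (*-suc g k) ⟨
  g * suc k + staircase d (suc k)        ∎
  where
  open ≡-Reasoning
  shuffle : ∀ g d x y → g + d + (x + y) ≡ g + x + (d + y)
  shuffle = solve-∀

staircase-suc : ∀ k → staircase 1 (suc k) ≡ suc k + staircase 1 k
staircase-suc k = cong suc (trans (staircase-+ 1 1 k) (cong (_+ staircase 1 k) (*-identityˡ k)))

addStaircase : ℕ → List ℕ → List ℕ
addStaircase d []       = []
addStaircase d (x ∷ xs) = x + d ∷ addStaircase (suc d) xs

subStaircase : ℕ → List ℕ → List ℕ
subStaircase d []       = []
subStaircase d (x ∷ xs) = x ∸ d ∷ subStaircase (suc d) xs

length-addStaircase : ∀ d xs → length (addStaircase d xs) ≡ length xs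
length-addStaircase d []       = refl
length-addStaircase d (x ∷ xs) = cong suc (length-addStaircase (suc d) xs)

length-subStaircase : ∀ d xs → length (subStaircase d xs) ≡ length xs
length-subStaircase d []       = refl
length-subStaircase d (x ∷ xs) = cong suc (length-subStaircase (suc d) xs)

subStaircase-addStaircase : ∀ d xs → subStaircase d (addStaircase d xs) ≡ xs
subStaircase-addStaircase d []       = refl
subStaircase-addStaircase d (x ∷ xs) = cong₂ _∷_ (m+n∸n≡m x d) (subStaircase-addStaircase (suc d) xs)

sum-addStaircase : ∀ d xs → sum (addStaircase d xs) ≡ sum xs + staircase d (length xs)
sum-addStaircase d []       = refl
sum-addStaircase d (x ∷ xs) = begin
  x + d + sum (addStaircase (suc d) xs)              ≡⟨ cong ((x + d) +_) (sum-addStaircase (suc d) xs) ⟩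
  x + d + (sum xs + staircase (suc d) (length xs))   ≡⟨ shuffle x d (sum xs) _ ⟩
  x + sum xs + (d + staircase (suc d) (length xs))   ∎
  where
  open ≡-Reasoning
  shuffle : ∀ x d s t → x + d + (s + t) ≡ x + s + (d + t)
  shuffle = solve-∀

addStaircase-sorted : ∀ d xs → Linked _>_ xs → All (1 ≤_) xs →
                      Linked _≥_ (addStaircase d xs ++ [ d + length xs ])
addStaircase-sorted d []           _         _         = [-]
addStaircase-sorted d (x ∷ [])     _         (1≤x ∷ _) =
  subst (_≤ x + d) (+-comm 1 d) (+-monoˡ-≤ d 1≤x) ∷ [-]
addStaircase-sorted d (x ∷ y ∷ xs) (y<x ∷ l) (_ ∷ ps)  =
  subst (λ b → Linked _≥_ (x + d ∷ addStaircase (suc d) (y ∷ xs) ++ [ b ])) (sym (+-suc d (suc (length xs))))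
    (subst (_≤ x + d) (sym (+-suc y d)) (+-monoˡ-≤ d y<x) ∷ addStaircase-sorted (suc d) (y ∷ xs) l ps)

subStaircase-sorted : ∀ d ys → Linked _≥_ (ys ++ [ d + length ys ]) →
  Linked _>_ (subStaircase d ys) × All (1 ≤_) (subStaircase d ys) × addStaircase d (subStaircase d ys) ≡ ys
subStaircase-sorted d []       _ = [] , [] , refl
subStaircase-sorted d (y ∷ ys) l
  with subStaircase-sorted (suc d) ys (subst (λ b → Linked _≥_ (ys ++ [ b ])) (+-suc d (length ys)) (Lk.tail l))
... | sorted , rest-positive , rest-eq =
  strict ys l (All.tail (Linked-≥-last (y ∷ ys) _ l)) sorted , positive ∷ rest-positive ,
  cong₂ _∷_ (m∸n+n≡m d≤y) rest-eq
  where
  b : ℕ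
  b = d + suc (length ys)
  b≤y : b ≤ y
  b≤y = All.head (Linked-≥-last (y ∷ ys) _ l)
  d≤y : d ≤ y
  d≤y = ≤-trans (m≤m+n d _) b≤y
  positive : 1 ≤ y ∸ d
  positive = ≤-trans (s≤s z≤n) (subst (_≤ y ∸ d) (m+n∸m≡n d _) (∸-monoˡ-≤ d b≤y))
  strict : ∀ zs → Linked _≥_ (y ∷ zs ++ [ b ]) → All (b ≤_) zs → Linked _>_ (subStaircase (suc d) zs) →
           Linked _>_ (y ∸ d ∷ subStaircase (suc d) zs)
  strict []       _         _         _      = [-]
  strict (z ∷ zs) (z≤y ∷ _) (b≤z ∷ _) sorted =
    <-≤-trans (∸-monoʳ-< (n<1+n d) (≤-trans (s≤s (m≤m+n d _)) (subst (_≤ z) (+-suc d _) b≤z)))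
              (∸-monoˡ-≤ d z≤y)
    ∷ sorted

raise : ℕ → List ℕ → List ℕ
raise zero    xs       = addStaircase 1 xs
raise (suc m) []       = []
raise (suc m) (x ∷ xs) = x ∷ raise m xs

lower : ℕ → List ℕ → List ℕ
lower zero    xs       = subStaircase 1 xs
lower (suc m) []       = []
lower (suc m) (x ∷ xs) = x ∷ lower m xs

lower-raise : ∀ m xs → lower m (raise m xs) ≡ xs
lower-raise zero    xs       = subStaircase-addStaircase 1 xs
lower-raise (suc m) []       = refl
lower-raise (suc m) (x ∷ xs) = cong (x ∷_) (lower-raise m xs)

length-raise : ∀ m xs → length (raise m xs) ≡ length xs
length-raise zero    xs       = length-addStaircase 1 xs
length-raise (suc m) []       = refl
length-raise (suc m) (x ∷ xs) = cong suc (length-raise m xs)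

length-lower : ∀ m xs → length (lower m xs) ≡ length xs
length-lower zero    xs       = length-subStaircase 1 xs
length-lower (suc m) []       = refl
length-lower (suc m) (x ∷ xs) = cong suc (length-lower m xs)

sum-raise : ∀ m xs → sum (raise m xs) ≡ sum xs + staircase 1 (length xs ∸ m)
sum-raise zero    xs       = sum-addStaircase 1 xs
sum-raise (suc m) []       = refl
sum-raise (suc m) (x ∷ xs) = trans (cong (x +_) (sum-raise m xs)) (sym (+-assoc x (sum xs) _))

raise-sorted : ∀ m h β r → Linked _>_ (h ∷ β) → All (1 ≤_) (h ∷ β) → length β ≡ r + m →
               Linked _≥_ (h ∷ raise m β ++ [ suc r ]) × Linked _>_ (h ∷ take m (raise m β))
raise-sorted zero    h β        r l ps ℓ≡ =
  subst₂ (λ x b → Linked _≥_ (x ∷ raise 0 β ++ [ b ])) (+-identityʳ h) (cong suc (trans ℓ≡ (+-identityʳ r)))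
    (addStaircase-sorted 0 (h ∷ β) l ps) ,
  [-]
raise-sorted (suc m) h []       r l ps ℓ≡ = contradiction (trans ℓ≡ (+-suc r m)) 0≢1+n
raise-sorted (suc m) h (y ∷ ys) r (y<h ∷ l) (_ ∷ ps) ℓ≡ =
  let (sorted , strict) = raise-sorted m y ys r l ps (suc-injective (trans ℓ≡ (+-suc r m)))
  in <⇒≤ y<h ∷ sorted , y<h ∷ strict

raise-lower : ∀ m h B r → Linked _≥_ (h ∷ B ++ [ suc r ]) → Linked _>_ (h ∷ take m B) → length B ≡ r + m →
              Linked _>_ (h ∷ lower m B) × All (1 ≤_) (lower m B) × raise m (lower m B) ≡ B
raise-lower zero    h B        r sorted _ ℓ≡
  with subStaircase-sorted 0 (h ∷ B)
         (subst (λ b → Linked _≥_ (h ∷ B ++ [ b ])) (cong suc (sym (trans ℓ≡ (+-identityʳ r)))) sorted)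
... | strict , _ ∷ positive , eq = strict , positive , LP.∷-injectiveʳ eq
raise-lower (suc m) h []       r _ _ ℓ≡ = contradiction (trans ℓ≡ (+-suc r m)) 0≢1+n
raise-lower (suc m) h (y ∷ ys) r (_ ∷ sorted) (y<h ∷ strict) ℓ≡
  with raise-lower m y ys r sorted strict (suc-injective (trans ℓ≡ (+-suc r m)))
... | strict′ , positive , eq =
  y<h ∷ strict′ ,
  ≤-trans (s≤s z≤n) (All.head (Linked-≥-last (y ∷ ys) (suc r) sorted)) ∷ positive ,
  cong (y ∷_) eq

-- The gaps of prev < x₁ < ⋯ < x_r < c as a partition with parts ≤ r + 1, in which
-- r + 2 − i occurs x_i − x_{i−1} − 1 times (x₀ = prev, x_{r+1} = c).
gaps : ℕ → List ℕ → ℕ → List ℕ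
gaps prev []       c = replicate (c ∸ suc prev) 1
gaps prev (x ∷ xs) c = replicate (x ∸ suc prev) (suc (suc (length xs))) ++ gaps x xs c

strip : ℕ → List ℕ → ℕ × List ℕ
strip v []       = 0 , []
strip v (y ∷ ys) with y ≟ v
... | yes _ = map₁ suc (strip v ys)
... | no  _ = 0 , y ∷ ys

ungaps : ℕ → ℕ → List ℕ → List ℕ × ℕ
ungaps prev zero    ν = [] , suc (prev + length ν)
ungaps prev (suc k) ν with strip (suc (suc k)) ν
... | g , rest = map₁ (suc (prev + g) ∷_) (ungaps (suc (prev + g)) k rest)

strip-replicate : ∀ v g rest → All (_< v) rest → strip v (replicate g v ++ rest) ≡ (g , rest)
strip-replicate v zero    []       _           = refl
strip-replicate v zero    (y ∷ ys) (y<v ∷ _) with y ≟ v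
... | yes refl = contradiction y<v (<-irrefl refl)
... | no  _    = refl
strip-replicate v (suc g) rest     ps with v ≟ v
... | yes _   = cong (map₁ suc) (strip-replicate v g rest ps)
... | no  v≢v = contradiction refl v≢v

strip-sorted : ∀ v ν → Linked _≥_ (suc v ∷ ν) →
               replicate (proj₁ (strip (suc v) ν)) (suc v) ++ proj₂ (strip (suc v) ν) ≡ ν ×
               Linked _≥_ (v ∷ proj₂ (strip (suc v) ν))
strip-sorted v []       _ = refl , [-]
strip-sorted v (y ∷ ys) (y≤ ∷ l) with y ≟ suc v
... | yes refl = let (eq , sorted) = strip-sorted v ys l in cong (suc v ∷_) eq , sorted
... | no  y≢   = refl , s≤s⁻¹ (≤∧≢⇒< y≤ y≢) ∷ l

length-ungaps : ∀ prev r ν → length (proj₁ (ungaps prev r ν)) ≡ r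
length-ungaps prev zero    ν = refl
length-ungaps prev (suc k) ν with strip (suc (suc k)) ν
... | g , rest = cong suc (length-ungaps (suc (prev + g)) k rest)

ungaps-increasing : ∀ prev r ν → Linked _<_ (prev ∷ proj₁ (ungaps prev r ν) ++ [ proj₂ (ungaps prev r ν) ])
ungaps-increasing prev zero    ν = s≤s (m≤m+n prev _) ∷ [-]
ungaps-increasing prev (suc k) ν with strip (suc (suc k)) ν
... | g , rest = s≤s (m≤m+n prev g) ∷ ungaps-increasing (suc (prev + g)) k rest

gaps-sorted : ∀ prev α c → Linked _<_ (prev ∷ α ++ [ c ]) →
              Linked _≥_ (suc (length α) ∷ gaps prev α c) × All (1 ≤_) (gaps prev α c)
gaps-sorted prev []       c _ =
  subst (λ xs → Linked _≥_ (1 ∷ xs)) (LP.++-identityʳ _) (Linked-≥-replicate 1 (c ∸ suc prev) [] [-]) ,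
  All.replicate⁺ _ ≤-refl
gaps-sorted prev (x ∷ xs) c (_ ∷ l) =
  let (sorted , positive) = gaps-sorted x xs c l
  in Linked-≥-replicate _ (x ∸ suc prev) _ (Linked-≥-weaken (n≤1+n _) sorted) ,
     All.++⁺ (All.replicate⁺ _ (s≤s z≤n)) positive

length-gaps : ∀ prev α c → Linked _<_ (prev ∷ α ++ [ c ]) → suc (prev + length α + length (gaps prev α c)) ≡ c
length-gaps prev []       c (prev<c ∷ _) =
  trans (cong (λ l → suc (prev + 0 + l)) (LP.length-replicate (c ∸ suc prev)))
        (trans (cong (λ p → suc (p + (c ∸ suc prev))) (+-identityʳ prev)) (m+[n∸m]≡n prev<c))
length-gaps prev (x ∷ xs) c (prev<x ∷ l) = begin
  suc (prev + suc k + length (replicate g L ++ rest))  ≡⟨ cong (λ t → suc (prev + suc k + t)) length-++-replicate ⟩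
  suc (prev + suc k + (g + length rest))               ≡⟨ shuffle prev k g (length rest) ⟩
  suc (suc prev + g + k + length rest)                 ≡⟨ cong (λ t → suc (t + k + length rest)) (m+[n∸m]≡n prev<x) ⟩
  suc (x + k + length rest)                            ≡⟨ length-gaps x xs c l ⟩
  c                                                    ∎
  where
  open ≡-Reasoning
  k L g : ℕ
  k = length xs
  L = suc (suc k)
  g = x ∸ suc prev
  rest : List ℕ
  rest = gaps x xs c
  length-++-replicate : length (replicate g L ++ rest) ≡ g + length rest
  length-++-replicate = trans (LP.length-++ (replicate g L)) (cong (_+ length rest) (LP.length-replicate g))
  shuffle : ∀ p k g l → suc (p + suc k + (g + l)) ≡ suc (suc p + g + k + l)
  shuffle = solve-∀

sum-gaps : ∀ prev α c → Linked _<_ (prev ∷ α ++ [ c ]) →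
           sum (gaps prev α c) + staircase (suc prev) (suc (length α)) ≡ c + sum α
sum-gaps prev []       c (prev<c ∷ _) = begin
  sum (replicate g 1) + (suc prev + 0)  ≡⟨ cong₂ _+_ (trans (sum-replicate g 1) (*-identityʳ g)) (+-identityʳ (suc prev)) ⟩
  g + suc prev                          ≡⟨ +-comm g (suc prev) ⟩
  suc prev + g                          ≡⟨ m+[n∸m]≡n prev<c ⟩
  c                                     ≡⟨ +-identityʳ c ⟨
  c + 0                                 ∎
  where
  open ≡-Reasoning
  g : ℕ
  g = c ∸ suc prev
sum-gaps prev (x ∷ xs) c (prev<x ∷ l) = begin
  sum (replicate g L ++ rest) + staircase (suc prev) L  ≡⟨ cong (_+ staircase (suc prev) L) sum-++-replicate ⟩
  g * L + sum rest + (suc prev + S)                     ≡⟨ cong (λ t → t + sum rest + (suc prev + S)) (*-suc g (suc k)) ⟩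
  g + g * suc k + sum rest + (suc prev + S)             ≡⟨ shuffle g (g * suc k) (sum rest) (suc prev) S ⟩
  sum rest + (g * suc k + S) + (suc prev + g)           ≡⟨ cong₂ (λ s t → sum rest + s + t) (sym shifted) x≡ ⟩
  sum rest + staircase (suc x) (suc k) + x              ≡⟨ cong (_+ x) (sum-gaps x xs c l) ⟩
  c + sum xs + x                                        ≡⟨ shuffle′ c (sum xs) x ⟩
  c + (x + sum xs)                                      ∎
  where
  open ≡-Reasoning
  k L g S : ℕ
  k = length xs
  L = suc (suc k)
  g = x ∸ suc prev
  S = staircase (suc (suc prev)) (suc k)
  rest : List ℕ
  rest = gaps x xs c
  x≡ : suc prev + g ≡ x
  x≡ = m+[n∸m]≡n prev<x
  sum-++-replicate : sum (replicate g L ++ rest) ≡ g * L + sum rest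
  sum-++-replicate = trans (sum-++ (replicate g L) rest) (cong (_+ sum rest) (sum-replicate g L))
  shifted : staircase (suc x) (suc k) ≡ g * suc k + S
  shifted = trans (cong (λ t → staircase t (suc k)) (trans (cong suc (sym x≡)) (+-comm (suc (suc prev)) g)))
                  (staircase-+ g (suc (suc prev)) (suc k))
  shuffle : ∀ g a s p t → g + a + s + (p + t) ≡ s + (a + t) + (p + g)
  shuffle = solve-∀
  shuffle′ : ∀ c s x → c + s + x ≡ c + (x + s)
  shuffle′ = solve-∀

ungaps-gaps : ∀ prev α c → Linked _<_ (prev ∷ α ++ [ c ]) → ungaps prev (length α) (gaps prev α c) ≡ (α , c)
ungaps-gaps prev []       c (prev<c ∷ _) =
  cong ([] ,_) (trans (cong (λ l → suc (prev + l)) (LP.length-replicate (c ∸ suc prev))) (m+[n∸m]≡n prev<c))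
ungaps-gaps prev (x ∷ xs) c (prev<x ∷ l)
  rewrite strip-replicate (suc (suc (length xs))) (x ∸ suc prev) (gaps x xs c)
            (All.map s≤s (Linked-head (flip ≤-trans) (proj₁ (gaps-sorted x xs c l))))
        | m+[n∸m]≡n prev<x
  = cong (map₁ (x ∷_)) (ungaps-gaps x xs c l)

gaps-ungaps : ∀ prev r ν → Linked _≥_ (suc r ∷ ν) → All (1 ≤_) ν →
              gaps prev (proj₁ (ungaps prev r ν)) (proj₂ (ungaps prev r ν)) ≡ ν
gaps-ungaps prev zero    ν sorted positive =
  trans (cong (λ g → replicate g 1) (m+n∸m≡n prev (length ν))) (replicate-one ν sorted positive)
gaps-ungaps prev (suc k) ν sorted positive with strip (suc (suc k)) ν | strip-sorted (suc k) ν sorted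
... | g , rest | ν≡ , rest-sorted = begin
  replicate (suc (prev + g) ∸ suc prev) (suc (suc (length α))) ++ gaps x α c
    ≡⟨ cong₂ (λ h l → replicate h (suc (suc l)) ++ gaps x α c) (m+n∸m≡n prev g) (length-ungaps x k rest) ⟩
  replicate g (suc (suc k)) ++ gaps x α c
    ≡⟨ cong (replicate g (suc (suc k)) ++_) (gaps-ungaps x k rest rest-sorted rest-positive) ⟩
  replicate g (suc (suc k)) ++ rest
    ≡⟨ ν≡ ⟩
  ν ∎
  where
  open ≡-Reasoning
  x : ℕ
  x = suc (prev + g)
  α : List ℕ
  α = proj₁ (ungaps x k rest)
  c : ℕ
  c = proj₂ (ungaps x k rest)
  rest-positive : All (1 ≤_) rest
  rest-positive = All.++⁻ʳ (replicate g _) (subst (All (1 ≤_)) (sym ν≡) positive)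

-- The core bijection

IsSusSplit : ℕ → ℕ → Split → Set
IsSusSplit m n (α , c , β) =
  Linked _<_ (0 ∷ α ++ [ c ]) × Linked _>_ (c ∷ β) × All (1 ≤_) β ×
  length β ≡ length α + m × c + (sum α + sum β) ≡ n

-- (B , r , ν) stands for the partition B ++ (r + 1) ∷ ν: its part r + 1 at index r + m puts m − 1 in the
-- rank-set, and the bound r + 1 + ℓ(ν) on the first part is condition (1), strict exactly when m > 0.
IsPartitionSplit : ℕ → ℕ → Split → Set
IsPartitionSplit m n (B , r , ν) =
  length B ≡ r + m × Linked _≥_ (suc r + length ν ∷ B ++ suc r ∷ ν) × Linked _>_ (suc r + length ν ∷ take m B) ×
  All (1 ≤_) ν × sum B + (suc r + sum ν) ≡ n

IsSusSplit-irrelevant : ∀ m n → U.Irrelevant (IsSusSplit m n)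
IsSusSplit-irrelevant m n {α , c , β} =
  Lk.irrelevant <-irrelevant ×-irrelevant Lk.irrelevant <-irrelevant ×-irrelevant All.irrelevant ≤-irrelevant ×-irrelevant
  ≡-irrelevant ×-irrelevant ≡-irrelevant

IsPartitionSplit-irrelevant : ∀ m n → U.Irrelevant (IsPartitionSplit m n)
IsPartitionSplit-irrelevant m n {B , r , ν} =
  ≡-irrelevant ×-irrelevant Lk.irrelevant ≤-irrelevant ×-irrelevant Lk.irrelevant <-irrelevant ×-irrelevant
  All.irrelevant ≤-irrelevant ×-irrelevant ≡-irrelevant

toPartitionSplit : ℕ → Split → Split
toPartitionSplit m (α , c , β) = raise m β , length α , gaps 0 α c

toSusSplit : ℕ → Split → Split
toSusSplit m (B , r , ν) = proj₁ (ungaps 0 r ν) , proj₂ (ungaps 0 r ν) , lower m B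

sum-raise-gaps : ∀ m α c β → Linked _<_ (0 ∷ α ++ [ c ]) → length β ≡ length α + m →
                 sum (raise m β) + (suc (length α) + sum (gaps 0 α c)) ≡ c + (sum α + sum β)
sum-raise-gaps m α c β inc ℓ≡ = begin
  sum (raise m β) + (suc r + sum ν)                ≡⟨ cong (_+ (suc r + sum ν)) (sum-raise m β) ⟩
  sum β + staircase 1 (length β ∸ m) + (suc r + sum ν)
    ≡⟨ cong (λ l → sum β + staircase 1 l + (suc r + sum ν)) (trans (cong (_∸ m) ℓ≡) (m+n∸n≡m r m)) ⟩
  sum β + staircase 1 r + (suc r + sum ν)          ≡⟨ shuffle (sum β) (staircase 1 r) (suc r) (sum ν) ⟩
  sum ν + (suc r + staircase 1 r) + sum β          ≡⟨ cong (λ t → sum ν + t + sum β) (staircase-suc r) ⟨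
  sum ν + staircase 1 (suc r) + sum β              ≡⟨ cong (_+ sum β) (sum-gaps 0 α c inc) ⟩
  c + sum α + sum β                                ≡⟨ +-assoc c (sum α) (sum β) ⟩
  c + (sum α + sum β)                              ∎
  where
  open ≡-Reasoning
  r : ℕ
  r = length α
  ν : List ℕ
  ν = gaps 0 α c
  shuffle : ∀ b t r v → b + t + (r + v) ≡ v + (r + t) + b
  shuffle = solve-∀

IsSusSplit⇒IsPartitionSplit : ∀ m n t → IsSusSplit m n t → IsPartitionSplit m n (toPartitionSplit m t)
IsSusSplit⇒IsPartitionSplit m n (α , c , β) (inc , dec , positive , ℓ≡ , wt) =
  trans (length-raise m β) ℓ≡ ,
  subst (λ h → Linked _≥_ (h ∷ raise m β ++ suc r ∷ ν)) (sym c≡)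
    (Linked-++-join (c ∷ raise m β) (suc r) ν (proj₁ raised) sortedν) ,
  subst (λ h → Linked _>_ (h ∷ take m (raise m β))) (sym c≡) (proj₂ raised) ,
  positiveν ,
  trans (sum-raise-gaps m α c β inc ℓ≡) wt
  where
  r : ℕ
  r = length α
  ν : List ℕ
  ν = gaps 0 α c
  c≡ : suc r + length ν ≡ c
  c≡ = length-gaps 0 α c inc
  raised : Linked _≥_ (c ∷ raise m β ++ [ suc r ]) × Linked _>_ (c ∷ take m (raise m β))
  raised = raise-sorted m c β r dec (Linked-<-last 0 α c inc ∷ positive) ℓ≡
  sortedν : Linked _≥_ (suc r ∷ ν)
  sortedν = proj₁ (gaps-sorted 0 α c inc)
  positiveν : All (1 ≤_) ν
  positiveν = proj₂ (gaps-sorted 0 α c inc)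

IsPartitionSplit⇒IsSusSplit : ∀ m n t → IsPartitionSplit m n t → IsSusSplit m n (toSusSplit m t)
IsPartitionSplit⇒IsSusSplit m n (B , r , ν) (ℓ≡ , sorted , strict , positiveν , wt) =
  inc , subst (λ h → Linked _>_ (h ∷ lower m B)) c≡ (proj₁ lowered) , proj₁ (proj₂ lowered) , ℓ≡′ , wt′
  where
  α : List ℕ
  α = proj₁ (ungaps 0 r ν)
  c : ℕ
  c = proj₂ (ungaps 0 r ν)
  inc : Linked _<_ (0 ∷ α ++ [ c ])
  inc = ungaps-increasing 0 r ν
  split : Linked _≥_ (suc r + length ν ∷ B ++ [ suc r ]) × Linked _≥_ (suc r ∷ ν)
  split = Linked-++-split (suc r + length ν ∷ B) (suc r) ν sorted
  gaps≡ : gaps 0 α c ≡ ν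
  gaps≡ = gaps-ungaps 0 r ν (proj₂ split) positiveν
  length≡ : length α ≡ r
  length≡ = length-ungaps 0 r ν
  c≡ : suc r + length ν ≡ c
  c≡ = trans (cong₂ (λ a b → suc (a + length b)) (sym length≡) (sym gaps≡)) (length-gaps 0 α c inc)
  lowered : Linked _>_ (suc r + length ν ∷ lower m B) × All (1 ≤_) (lower m B) × raise m (lower m B) ≡ B
  lowered = raise-lower m (suc r + length ν) B r (proj₁ split) strict ℓ≡
  ℓ≡′ : length (lower m B) ≡ length α + m
  ℓ≡′ = trans (length-lower m B) (trans ℓ≡ (cong (_+ m) (sym length≡)))
  wt′ : c + (sum α + sum (lower m B)) ≡ n
  wt′ = trans (sym (sum-raise-gaps m α c (lower m B) inc ℓ≡′))
          (trans (cong₂ (λ b t → sum b + t) (proj₂ (proj₂ lowered)) (cong₂ (λ a b → suc a + sum b) length≡ gaps≡))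
                 wt)

toPartitionSplit-toSusSplit : ∀ m n t → IsPartitionSplit m n t → toPartitionSplit m (toSusSplit m t) ≡ t
toPartitionSplit-toSusSplit m n (B , r , ν) (ℓ≡ , sorted , strict , positiveν , _) =
  cong₂ _,_ (proj₂ (proj₂ (raise-lower m (suc r + length ν) B r (proj₁ split) strict ℓ≡)))
            (cong₂ _,_ (length-ungaps 0 r ν) (gaps-ungaps 0 r ν (proj₂ split) positiveν))
  where
  split : Linked _≥_ (suc r + length ν ∷ B ++ [ suc r ]) × Linked _≥_ (suc r ∷ ν)
  split = Linked-++-split (suc r + length ν ∷ B) (suc r) ν sorted

toSusSplit-toPartitionSplit : ∀ m α c β → Linked _<_ (0 ∷ α ++ [ c ]) →
                              toSusSplit m (toPartitionSplit m (α , c , β)) ≡ (α , c , β)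
toSusSplit-toPartitionSplit m α c β inc =
  cong₂ (λ (α′ , c′) β′ → α′ , c′ , β′) (ungaps-gaps 0 α c inc) (lower-raise m β)

susSplit↔partitionSplit : ∀ m n → Σ Split (IsSusSplit m n) ↔ Σ Split (IsPartitionSplit m n)
susSplit↔partitionSplit m n = mk↔-Σ (IsSusSplit-irrelevant m n) (IsPartitionSplit-irrelevant m n)
  (λ (t , p) → toPartitionSplit m t , IsSusSplit⇒IsPartitionSplit m n t p)
  (λ (t , p) → toSusSplit m t , IsPartitionSplit⇒IsSusSplit m n t p)
  (λ (t , p) → toPartitionSplit-toSusSplit m n t p)
  (λ ((α , c , β) , p) → toSusSplit-toPartitionSplit m α c β (proj₁ p))

length-rank⇔ : ∀ a b m → (a + suc b + 1 ≡ m + 2 * suc a) ⇔ (b ≡ a + m)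
length-rank⇔ a b m = mk⇔
  (λ e → +-cancelʳ-≡ (a + 2) b (a + m) (trans (sym (lhs a b)) (trans e (rhs a m))))
  (λ { refl → trans (lhs a (a + m)) (sym (rhs a m)) })
  where
  lhs : ∀ a b → a + suc b + 1 ≡ b + (a + 2)
  lhs = solve-∀
  rhs : ∀ a m → m + 2 * suc a ≡ a + m + (a + 2)
  rhs = solve-∀

IsSUS⇒IsSusSplit : ∀ m n a (s : IsSUS m n a) → IsSusSplit m n (pivotAt (pred (proj₁ s)) a)
IsSUS⇒IsSusSplit m n a (suc r , _ , r<ℓ , inc , dec , positive , wt , rk) with pivot? {r} {a} r<ℓ
... | pivot α c β = subst (IsSusSplit m n) (sym (pivotAt-join α c β))
  ( Linked-0∷ (subst (Linked _<_) (take-join α c β) inc)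
      (All.++⁺ (All.++⁻ˡ α positive) (All.head (All.++⁻ʳ α positive) ∷ []))
  , subst (Linked _>_) (drop-join α c β) dec
  , All.tail (All.++⁻ʳ α positive)
  , Equivalence.to (length-rank⇔ (length α) (length β) m)
      (trans (cong (_+ 1) (sym (length-join α c β)))
             (Equivalence.to (rank-sus⇔ (length (join (α , c , β))) (suc (length α)) m) rk))
  , trans (sym (sum-join α c β)) wt )

IsSusSplit⇒IsSUS : ∀ m n t → IsSusSplit m n t → IsSUS m n (join t)
IsSusSplit⇒IsSUS m n (α , c , β) (inc , dec , positiveβ , ℓ≡ , wt) =
  suc (length α) , s≤s z≤n ,
  subst (suc (length α) ≤_) (sym (length-join α c β)) (m<m+n (length α) (s≤s z≤n)) ,
  subst (Linked _<_) (sym (take-join α c β)) (Lk.tail inc) ,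
  subst (Linked _>_) (sym (drop-join α c β)) dec ,
  All.++⁺ (All.++⁻ˡ α positiveαc) (All.head (All.++⁻ʳ α positiveαc) ∷ positiveβ) ,
  trans (sum-join α c β) wt ,
  Equivalence.from (rank-sus⇔ (length (join (α , c , β))) (suc (length α)) m)
    (trans (cong (_+ 1) (length-join α c β)) (Equivalence.from (length-rank⇔ (length α) (length β) m) ℓ≡))
  where
  positiveαc : All (0 <_) (α ++ [ c ])
  positiveαc = Linked-head <-trans inc

peak-unique : ∀ ℓ k k′ m → (ℤ.+ ℓ ℤ.- ℤ.+ (2 * k)) ℤ.+ 1ℤ ≡ ℤ.+ m → (ℤ.+ ℓ ℤ.- ℤ.+ (2 * k′)) ℤ.+ 1ℤ ≡ ℤ.+ m →
              k ≡ k′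
peak-unique ℓ k k′ m e e′ = *-cancelˡ-≡ k k′ 2 (+-cancelˡ-≡ m (2 * k) (2 * k′)
  (trans (sym (Equivalence.to (rank-sus⇔ ℓ k m) e)) (Equivalence.to (rank-sus⇔ ℓ k′ m) e′)))

IsSUS-irrelevant : ∀ m n → U.Irrelevant (IsSUS m n)
IsSUS-irrelevant m n {a} (k , p@(_ , _ , _ , _ , _ , _ , rk)) (k′ , p′@(_ , _ , _ , _ , _ , _ , rk′))
  with peak-unique (length a) k k′ m rk rk′
... | refl = cong (k ,_)
  ((≤-irrelevant ×-irrelevant ≤-irrelevant ×-irrelevant Lk.irrelevant <-irrelevant ×-irrelevant
    Lk.irrelevant <-irrelevant ×-irrelevant All.irrelevant ≤-irrelevant ×-irrelevant ≡-irrelevant ×-irrelevant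
    ℤ-≡-irrelevant) p p′)

USet↔susSplit : ∀ m n → USet m n ↔ Σ Split (IsSusSplit m n)
USet↔susSplit m n = mk↔-Σ (IsSUS-irrelevant m n) (IsSusSplit-irrelevant m n)
  (λ (a , s) → pivotAt (pred (proj₁ s)) a , IsSUS⇒IsSusSplit m n a s)
  (λ (t , p) → join t , IsSusSplit⇒IsSUS m n t p)
  (λ ((α , c , β) , _) → pivotAt-join α c β)
  λ { (a , suc r , _ , r<ℓ , _) → join-pivotAt r<ℓ }

InPSet : ℕ → ℕ → List ℕ → Set
InPSet m n λs = IsPartitionOf n λs × Cond1 m λs × InRankSet (ℤ.+ m ℤ.- 1ℤ) λs × Cond3 m λs

Under-head⇔ : ∀ m c λs → 0 < length λs → Linked _≥_ λs → Linked _>_ (take m λs) →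
              Under m (nth λs 0) c ⇔ (Linked _≥_ (c ∷ λs) × Linked _>_ (c ∷ take m λs))
Under-head⇔ zero    c (x ∷ xs) _ sorted _      = mk⇔ (λ x≤c → x≤c ∷ sorted , [-]) (λ (l , _) → Lk.head l)
Under-head⇔ (suc k) c (x ∷ xs) _ sorted strict =
  mk⇔ (λ x<c → <⇒≤ x<c ∷ sorted , x<c ∷ strict) (λ (_ , l) → Lk.head l)

rankSet-index<length : ∀ m λs j → Cond1 m λs → j + 1 ≡ m + nth λs j → j < length λs
rankSet-index<length m λs j c1 e with j <? length λs
... | yes j<ℓ = j<ℓ
... | no  j≮ℓ =
  contradiction (trans e (cong (m +_) (nth-beyond λs j (≮⇒≥ j≮ℓ)))) (beyond m (Equivalence.to (cond1⇔ m λs) c1))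
  where
  beyond : ∀ m → Under m (nth λs 0 + m) (length λs) → j + 1 ≢ m + 0
  beyond zero    _ e = 1+n≢0 (trans (+-comm 1 j) e)
  beyond (suc k) u e = <-irrefl refl (begin-strict
    j + 1             ≡⟨ trans e (+-identityʳ (suc k)) ⟩
    suc k             ≤⟨ m≤n+m (suc k) (nth λs 0) ⟩
    nth λs 0 + suc k  <⟨ u ⟩
    length λs         ≤⟨ ≮⇒≥ j≮ℓ ⟩
    j                 <⟨ m<m+n j (s≤s z≤n) ⟩
    j + 1             ∎)
    where open ≤-Reasoning

rankSet-index-unique-< : ∀ {λs} m i j → Linked _≥_ λs → i < j → i + 1 ≡ m + nth λs i → j + 1 ≢ m + nth λs j
rankSet-index-unique-< {λs} m i j sorted i<j eᵢ eⱼ = <-irrefl refl (begin-strict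
  j + 1             ≡⟨ eⱼ ⟩
  m + nth λs j      ≤⟨ +-monoʳ-≤ m (nth-antitone i j sorted (<⇒≤ i<j)) ⟩
  m + nth λs i      ≡⟨ eᵢ ⟨
  i + 1             <⟨ +-monoˡ-< 1 i<j ⟩
  j + 1             ∎)
  where open ≤-Reasoning

rankSet-index-unique : ∀ {λs} m i j → Linked _≥_ λs → i + 1 ≡ m + nth λs i → j + 1 ≡ m + nth λs j → i ≡ j
rankSet-index-unique m i j sorted eᵢ eⱼ with <-cmp i j
... | tri< i<j _ _ = contradiction eⱼ (rankSet-index-unique-< m i j sorted i<j eᵢ)
... | tri≈ _ i≡j _ = i≡j
... | tri> _ _ j<i = contradiction eᵢ (rankSet-index-unique-< m j i sorted j<i eⱼ)

Cond1-irrelevant : ∀ m λs → Irrelevant (Cond1 m λs)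
Cond1-irrelevant zero    λs = ℤ.≤-irrelevant
Cond1-irrelevant (suc k) λs = ℤ.≤-irrelevant

InPSet-irrelevant : ∀ m n → U.Irrelevant (InPSet m n)
InPSet-irrelevant m n {λs} (part , c1 , (j , e) , c3) (part′ , c1′ , (j′ , e′) , c3′)
  with rankSet-index-unique m j j′ (proj₁ part) (Equivalence.to (rank-set⇔ j _ m) e)
                                                (Equivalence.to (rank-set⇔ j′ _ m) e′)
... | refl = cong₂ _,_
  ((Lk.irrelevant ≤-irrelevant ×-irrelevant All.irrelevant ≤-irrelevant ×-irrelevant ≡-irrelevant) part part′)
  (cong₂ _,_ (Cond1-irrelevant m λs c1 c1′)
    (cong₂ _,_ (cong (j ,_) (ℤ-≡-irrelevant e e′)) (Lk.irrelevant <-irrelevant c3 c3′)))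

joinPartition : Split → List ℕ
joinPartition (B , r , ν) = join (B , suc r , ν)

partitionSplitAt : ℕ → List ℕ → Split
partitionSplitAt j λs = take j λs , pred (nth λs j) , drop (suc j) λs

partitionSplitAt-joinPartition : ∀ B r ν → partitionSplitAt (length B) (joinPartition (B , r , ν)) ≡ (B , r , ν)
partitionSplitAt-joinPartition B r ν = cong (λ (B , p , ν) → B , pred p , ν) (pivotAt-join B (suc r) ν)

joinPartition-partitionSplitAt : ∀ j λs → j < length λs → All (1 ≤_) λs → joinPartition (partitionSplitAt j λs) ≡ λs
joinPartition-partitionSplitAt j λs j<ℓ positive =
  trans (cong (λ p → take j λs ++ p ∷ drop (suc j) λs) (suc-pred (nth λs j) {{>-nonZero (nth∈All j j<ℓ positive)}}))
        (join-pivotAt j<ℓ)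

length-joinPartition : ∀ m B r ν → length B ≡ r + m → length (joinPartition (B , r , ν)) ≡ suc r + length ν + m
length-joinPartition m B r ν ℓ≡ =
  trans (length-join B (suc r) ν) (trans (cong (_+ suc (length ν)) ℓ≡) (shuffle r m (length ν)))
  where
  shuffle : ∀ r m l → r + m + suc l ≡ suc r + l + m
  shuffle = solve-∀

take-joinPartition : ∀ m B r ν → length B ≡ r + m → take m (joinPartition (B , r , ν)) ≡ take m B
take-joinPartition m B r ν ℓ≡ = take-++ˡ m B _ (subst (m ≤_) (sym ℓ≡) (m≤n+m m r))

cond1-joinPartition⇔ : ∀ m B r ν → length B ≡ r + m →
  Cond1 m (joinPartition (B , r , ν)) ⇔ Under m (nth (joinPartition (B , r , ν)) 0) (suc r + length ν)
cond1-joinPartition⇔ m B r ν ℓ≡ =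
  Under-+ʳ⇔ m (nth λs 0) (suc r + length ν) ⇔-∘
  subst (λ l → Cond1 m λs ⇔ Under m (nth λs 0 + m) l) (length-joinPartition m B r ν ℓ≡) (cond1⇔ m λs)
  where
  λs : List ℕ
  λs = joinPartition (B , r , ν)

cond3-joinPartition⇔ : ∀ m B r ν → length B ≡ r + m → Cond3 m (joinPartition (B , r , ν)) ⇔ Linked _>_ (take m B)
cond3-joinPartition⇔ m B r ν ℓ≡ = mk⇔ (subst (Linked _>_) map≡take) (subst (Linked _>_) (sym map≡take))
  where
  λs : List ℕ
  λs = joinPartition (B , r , ν)
  map≡take : map (nth λs) (upTo m) ≡ take m B
  map≡take = trans (map-nth-upTo m λs (subst (m ≤_) (sym (length-joinPartition m B r ν ℓ≡)) (m≤n+m m _)))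
                   (take-joinPartition m B r ν ℓ≡)

Under-joinPartition⇔ : ∀ m B r ν → length B ≡ r + m → Linked _≥_ (joinPartition (B , r , ν)) → Linked _>_ (take m B) →
  Under m (nth (joinPartition (B , r , ν)) 0) (suc r + length ν) ⇔
  (Linked _≥_ (suc r + length ν ∷ joinPartition (B , r , ν)) × Linked _>_ (suc r + length ν ∷ take m B))
Under-joinPartition⇔ m B r ν ℓ≡ sorted strict =
  subst (λ ps → Under m (nth λs 0) c ⇔ (Linked _≥_ (c ∷ λs) × Linked _>_ (c ∷ ps))) (take-joinPartition m B r ν ℓ≡)
    (Under-head⇔ m _ λs (subst (0 <_) (sym (length-joinPartition m B r ν ℓ≡)) (s≤s z≤n)) sorted
      (subst (Linked _>_) (sym (take-joinPartition m B r ν ℓ≡)) strict))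
  where
  c : ℕ
  c = suc r + length ν
  λs : List ℕ
  λs = joinPartition (B , r , ν)

join-InPSet⇒IsPartitionSplit : ∀ m n B p ν → length B + 1 ≡ m + p → IsPartitionOf n (join (B , p , ν)) →
  Cond1 m (join (B , p , ν)) → Cond3 m (join (B , p , ν)) → IsPartitionSplit m n (B , pred p , ν)
join-InPSet⇒IsPartitionSplit m n B zero    ν _ (_ , positive , _) _ _ =
  contradiction (All.head (All.++⁻ʳ B positive)) λ ()
join-InPSet⇒IsPartitionSplit m n B (suc r) ν e (sorted , positive , wt) c1 c3 =
  ℓ≡ , proj₁ bounded , proj₂ bounded , All.tail (All.++⁻ʳ B positive) , trans (sym (sum-++ B (suc r ∷ ν))) wt
  where
  ℓ≡ : length B ≡ r + m
  ℓ≡ = +-cancelʳ-≡ 1 (length B) (r + m) (trans e (shuffle m r))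
    where
    shuffle : ∀ m r → m + suc r ≡ r + m + 1
    shuffle = solve-∀
  bounded : Linked _≥_ (suc r + length ν ∷ joinPartition (B , r , ν)) × Linked _>_ (suc r + length ν ∷ take m B)
  bounded = Equivalence.to (Under-joinPartition⇔ m B r ν ℓ≡ sorted (Equivalence.to (cond3-joinPartition⇔ m B r ν ℓ≡) c3))
              (Equivalence.to (cond1-joinPartition⇔ m B r ν ℓ≡) c1)

InPSet⇒IsPartitionSplit : ∀ m n λs j → IsPartitionOf n λs → Cond1 m λs → j + 1 ≡ m + nth λs j → Cond3 m λs →
                          IsPartitionSplit m n (partitionSplitAt j λs)
InPSet⇒IsPartitionSplit m n λs j part c1 e c3 with pivot? {j} {λs} (rankSet-index<length m λs j c1 e)
... | pivot B p ν = subst (IsPartitionSplit m n) (cong (λ (B , p , ν) → B , pred p , ν) (sym (pivotAt-join B p ν)))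
                      (join-InPSet⇒IsPartitionSplit m n B p ν (trans e (cong (m +_) (nth-join B p ν))) part c1 c3)

IsPartitionSplit⇒InPSet : ∀ m n t → IsPartitionSplit m n t → InPSet m n (joinPartition t)
IsPartitionSplit⇒InPSet m n (B , r , ν) (ℓ≡ , sorted , strict , positiveν , wt) =
  (Lk.tail sorted , positive , trans (sum-++ B (suc r ∷ ν)) wt) ,
  Equivalence.from (cond1-joinPartition⇔ m B r ν ℓ≡)
    (Equivalence.from (Under-joinPartition⇔ m B r ν ℓ≡ (Lk.tail sorted) (Lk.tail strict)) (sorted , strict)) ,
  (length B , Equivalence.from (rank-set⇔ (length B) _ m) rank-eq) ,
  Equivalence.from (cond3-joinPartition⇔ m B r ν ℓ≡) (Lk.tail strict)
  where
  positive : All (1 ≤_) (joinPartition (B , r , ν))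
  positive = All.++⁺
    (All.map (≤-trans (s≤s z≤n)) (Linked-≥-last B (suc r) (proj₁ (Linked-++-split B (suc r) ν (Lk.tail sorted)))))
    (s≤s z≤n ∷ positiveν)
  rank-eq : length B + 1 ≡ m + nth (joinPartition (B , r , ν)) (length B)
  rank-eq = trans (cong (_+ 1) ℓ≡) (trans (shuffle r m) (cong (m +_) (sym (nth-join B (suc r) ν))))
    where
    shuffle : ∀ r m → r + m + 1 ≡ m + suc r
    shuffle = solve-∀

partitionSplit↔PSet : ∀ m n → Σ Split (IsPartitionSplit m n) ↔ PSet m n
partitionSplit↔PSet m n = mk↔-Σ (IsPartitionSplit-irrelevant m n) (InPSet-irrelevant m n)
  (λ (t , p) → joinPartition t , IsPartitionSplit⇒InPSet m n t p)
  (λ (λs , part , c1 , (j , e) , c3) →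
     partitionSplitAt j λs , InPSet⇒IsPartitionSplit m n λs j part c1 (Equivalence.to (rank-set⇔ j _ m) e) c3)
  (λ (λs , part , c1 , (j , e) , c3) →
     joinPartition-partitionSplitAt j λs (rankSet-index<length m λs j c1 (Equivalence.to (rank-set⇔ j _ m) e))
                                    (proj₁ (proj₂ part)))
  (λ ((B , r , ν) , _) → partitionSplitAt-joinPartition B r ν)

IsSUS? : ∀ m n → U.Decidable (IsSUS m n)
IsSUS? m n a = Dec.map′
  (λ (k , k<1+ℓ , 1≤k , rest) → k , 1≤k , s≤s⁻¹ k<1+ℓ , rest)
  (λ (k , 1≤k , k≤ℓ , rest) → k , s≤s k≤ℓ , 1≤k , rest)
  (anyUpTo? (λ k → 1 ≤? k ×-dec Lk.linked? _<?_ (take k a) ×-dec Lk.linked? _>?_ (drop (k ∸ 1) a) ×-dec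
                   All.all? (1 ≤?_) a ×-dec sum a ≟ n ×-dec (ℤ.+ length a ℤ.- ℤ.+ (2 * k)) ℤ.+ 1ℤ ℤ.≟ ℤ.+ m)
            (suc (length a)))

boundedLists : ℕ → ℕ → List (List ℕ)
boundedLists n zero    = [ [] ]
boundedLists n (suc ℓ) = [] ∷ cartesianProductWith _∷_ (upTo (suc n)) (boundedLists n ℓ)

∈-boundedLists : ∀ n ℓ a → length a ≤ ℓ → All (_≤ n) a → a ∈ boundedLists n ℓ
∈-boundedLists n zero    []      _         _          = here refl
∈-boundedLists n (suc ℓ) []      _         _          = here refl
∈-boundedLists n (suc ℓ) (x ∷ a) (s≤s a≤ℓ) (x≤n ∷ a≤n) =
  there (∈-cartesianProductWith⁺ _∷_ (∈-upTo⁺ (s≤s x≤n)) (∈-boundedLists n ℓ a a≤ℓ a≤n))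

length≤sum : ∀ a → All (1 ≤_) a → length a ≤ sum a
length≤sum []      _          = z≤n
length≤sum (x ∷ a) (1≤x ∷ ps) = +-mono-≤ 1≤x (length≤sum a ps)

All≤sum : ∀ a → All (_≤ sum a) a
All≤sum []      = []
All≤sum (x ∷ a) = m≤m+n x (sum a) ∷ All.map (λ y≤ → ≤-trans y≤ (m≤n+m (sum a) x)) (All≤sum a)

IsSUS⊆boundedLists : ∀ m n {a} → IsSUS m n a → a ∈ boundedLists n n
IsSUS⊆boundedLists m n {a} (_ , _ , _ , _ , _ , positive , refl , _) =
  ∈-boundedLists (sum a) (sum a) a (length≤sum a positive) (All≤sum a)

USet↔PSet : ∀ m n → USet m n ↔ PSet m n
USet↔PSet m n = ↔-trans (USet↔susSplit m n) (↔-trans (susSplit↔partitionSplit m n) (partitionSplit↔PSet m n))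

theorem1p4 : (m n : ℕ) → Σ ℕ (λ k → (USet m n HasSize k) × (PSet m n HasSize k))
theorem1p4 m n =
  let (k , USet↔Fin) = finite (LP.≡-dec _≟_) (boundedLists n n) (IsSUS m n) (IsSUS? m n)
                              (IsSUS-irrelevant m n) (IsSUS⊆boundedLists m n)
  in k , USet↔Fin , ↔-trans (↔-sym (USet↔PSet m n)) USet↔Fin
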